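{- Let $k$ be a positive integer and $n\ge k-3$. Nonnegative integers $a\le b\le c$ are the cardinalities of the Venn regions, other than the isolated point set, of some cap $S\subseteq\mathbb{F}_2^n$ with $|S|=k$ and $\dim S=k-3$ if and only if (1) $a+b+c\le k$; (2) $a$, $b$, $c$ all have the same parity; (3) $a+b\ge 6$.
   Context: The dimension of $S$ is that of its affine span. A cap is a subset of $\mathbb{F}_2^n$ containing no four distinct elements summing to $\vec 0$. $E(S)$ is the $\mathbb{F}_2$-subspace (under symmetric difference) of $\mathcal{P}(S)$ consisting of even-size subsets of $S$ whose elements sum to $\vec 0$ (including $\varnothing$); when $|S|=k$ and $\dim S=k-3$, $\dim E(S)=2$. For a basis $(X_1,X_2)$ of $E(S)$ the Venn regions are $X_1\cap X_2$, $X_1\setminus X_2$, $X_2\setminus X_1$ and the isolated point set $S\setminus(X_1\cup X_2)$. -}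

module Defs where

open import Data.Bool using (Bool; true; false; _xor_; if_then_else_)
open import Data.Nat using (ℕ; zero; suc; _+_; _≤_; _%_)
open import Data.Fin using (Fin; zero; suc)
open import Data.Fin.Subset using (Subset; _∈_; _⊆_; _∩_; _─_; ∣_∣; ⊥)
open import Data.Vec using (Vec; []; _∷_; replicate; zipWith; lookup)
open import Data.Product using (Σ; _×_; ∃)
open import Data.Sum using (_⊎_)
open import Relation.Binary.PropositionalEquality using (_≡_; _≢_)
open import Relation.Nullary using (¬_)
open import Function.Definitions using (Injective)

F2^ : ℕ → Set
F2^ n = Vec Bool n

0v : ∀ {n} → F2^ n
0v = replicate _ false

_⊕_ : ∀ {n} → F2^ n → F2^ n → F2^ n
_⊕_ = zipWith _xor_

-- A k-element subset S of F₂ⁿ is given as an injective enumeration Fin k → F₂ⁿ.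
Points : ℕ → ℕ → Set
Points k n = Fin k → F2^ n

IsSet : ∀ {k n} → Points k n → Set
IsSet S = Injective _≡_ _≡_ S

subsetSum : ∀ {k n} → Points k n → Subset k → F2^ n
subsetSum {zero}  S []        = 0v
subsetSum {suc k} S (b ∷ U)   =
  (if b then S zero else 0v) ⊕ subsetSum (λ i → S (suc i)) U

Even : ℕ → Set
Even m = m % 2 ≡ 0

IsCap : ∀ {k n} → Points k n → Set
IsCap S = ∀ i j l m → i ≢ j → i ≢ l → i ≢ m → j ≢ l → j ≢ m → l ≢ m →
          ((S i ⊕ S j) ⊕ (S l ⊕ S m)) ≢ 0v

InE : ∀ {k n} → Points k n → Subset k → Set
InE S U = Even ∣ U ∣ × subsetSum S U ≡ 0v

AffIndep : ∀ {k n} → Points k n → Subset k → Set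
AffIndep S T = ∀ U → U ⊆ T → InE S U → U ≡ ⊥

-- dim S = d : the affine span of S has dimension d, i.e. the maximum number of
-- affinely independent points of S is d + 1.
HasDim : ∀ {k n} → Points k n → ℕ → Set
HasDim S d = (∃ λ T → AffIndep S T × ∣ T ∣ ≡ suc d)
           × (∀ T → AffIndep S T → ∣ T ∣ ≤ suc d)

_△_ : ∀ {k} → Subset k → Subset k → Subset k
_△_ = zipWith _xor_

IsBasisE : ∀ {k n} → Points k n → Subset k → Subset k → Set
IsBasisE S X₁ X₂ =
  InE S X₁ × InE S X₂ ×
  -- linear independence over F₂
  X₁ ≢ ⊥ × X₂ ≢ ⊥ × X₁ ≢ X₂ ×
  (∀ Y → InE S Y → Y ≡ ⊥ ⊎ Y ≡ X₁ ⊎ Y ≡ X₂ ⊎ Y ≡ (X₁ △ X₂))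

SameMultiset3 : ℕ → ℕ → ℕ → ℕ → ℕ → ℕ → Set
SameMultiset3 x y z a b c =
    (x ≡ a × y ≡ b × z ≡ c) ⊎ (x ≡ a × y ≡ c × z ≡ b)
  ⊎ (x ≡ b × y ≡ a × z ≡ c) ⊎ (x ≡ b × y ≡ c × z ≡ a)
  ⊎ (x ≡ c × y ≡ a × z ≡ b) ⊎ (x ≡ c × y ≡ b × z ≡ a)

-- a, b, c are the cardinalities of the non-isolated Venn regions
-- X₁∩X₂, X₁∖X₂, X₂∖X₁ for some basis of E(S), for some cap S ⊆ F₂ⁿ
-- with |S| = k and dim S = k - 3 (written dim S + 3 = k).
VennRealizable : ℕ → ℕ → ℕ → ℕ → ℕ → Set
VennRealizable k n a b c =
  Σ (Points k n) λ S → IsSet S × IsCap S × Σ ℕ λ d → HasDim S d × d + 3 ≡ k ×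
  Σ (Subset k) λ X₁ → Σ (Subset k) λ X₂ → IsBasisE S X₁ X₂ ×
  SameMultiset3 (∣ X₁ ∩ X₂ ∣) (∣ X₁ ─ X₂ ∣) (∣ X₂ ─ X₁ ∣) a b c

SameParity : ℕ → ℕ → Set
SameParity x y = x % 2 ≡ y % 2

-- Write x, y, z for the sizes of the regions X₁ ∩ X₂, X₁ ∖ X₂, X₂ ∖ X₁ of a basis of E(S). The nonzero
-- elements of E(S) are X₁, X₂ and X₁ △ X₂, of sizes x + y, x + z and y + z. For an injective S, being a
-- cap says exactly that no nonzero element of E(S) has 2 or 4 points, i.e. that these three even sizes
-- are at least 6; for x ≤ y ≤ z this is the stated criterion. Conversely, such x, y, z with
-- x + y + z ≤ k are realised by S = {0, ū, v̄, e₁, …, e_{k-3}} ⊆ F₂ⁿ, where the e_j are unit vectors and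
-- u, v ∈ F₂^{k-3} satisfy |u ∩ v| = x, |u ∖ v| = y − 2, |v ∖ u| = z − 1: as the e_j are independent,
-- E(S) is spanned by X₁ = {0, ū} ∪ supp u and X₂ = {v̄} ∪ supp v, and {0, e₁, …, e_{k-3}} is a maximal
-- affinely independent subset.

module Submission where

open import Defs
open import Level using (0ℓ)
open import Algebra.Bundles using (AbelianGroup)
open import Algebra.Structures using (IsAbelianGroup)
open import Data.Bool using (Bool; true; false; _xor_; if_then_else_)
open import Data.Bool.Properties using (if-eta; xor-assoc; xor-comm; xor-identityˡ; xor-identityʳ; xor-same)
open import Data.Empty using (⊥-elim)
open import Data.Fin using (Fin; zero; suc; _≟_)
open import Data.Fin.Properties using (suc-injective; any?)
open import Data.Fin.Subset using (Subset; _∈_; _∉_; _⊆_; _∩_; _∪_; _─_; ∣_∣; ⊥; ⊤; ⁅_⁆)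
open import Data.Fin.Subset.Properties
  using (_∈?_; ∉⊥; ∣⊥∣≡0; ∣⊤∣≡n; ∣p∣≤n; x∈⁅x⁆; x≢y⇒x∉⁅y⁆; ∩-comm; p⊆p∪q; x∈p∪q⁺; x∈p∪q⁻; p⊂q⇒∣p∣<∣q∣)
open import Data.List using (List; []; _∷_; length; map; foldr)
open import Data.List.Relation.Unary.All using (All; []; _∷_; universal)
import Data.List.Relation.Unary.All.Properties as All
open import Data.List.Relation.Unary.AllPairs using ([]; _∷_)
open import Data.List.Relation.Unary.Unique.Propositional using (Unique)
import Data.List.Relation.Unary.Unique.Propositional.Properties as Unique
open import Data.Nat using (ℕ; zero; suc; _+_; _≤_; _<_; z≤n; s≤s; s≤s⁻¹)
open import Data.Nat.Tactic.RingSolver using (solve-∀)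
open import Data.Nat.Properties
  using (+-comm; +-assoc; +-suc; ≤-trans; +-monoʳ-≤; +-monoˡ-≤; m≤m+n; m≤n⇒m≤1+n; 0≢1+n; m≤n⇒∃[o]m+o≡n; +-cancelˡ-≤)
open import Data.Product using (_×_; _,_; proj₁; proj₂; ∃)
open import Data.Sum using (_⊎_; inj₁; inj₂; [_,_]′)
open import Data.Vec using (Vec; []; _∷_; replicate; _++_; here; there)
open import Data.Vec.Properties using (zipWith-assoc; zipWith-comm; zipWith-identityˡ; zipWith-identityʳ; ∷-injective)
open import Function using (id; _∘_; case_of_)
open import Function.Bundles using (_⇔_; mk⇔; Equivalence)
open import Function.Properties.Equivalence using () renaming (trans to ⇔-trans)
open import Relation.Binary.PropositionalEquality
open import Relation.Nullary using (yes; no)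
open import Relation.Nullary.Decidable using (decidable-stable; _×-dec_; ¬?)

⊕-self : ∀ {n} (x : F2^ n) → x ⊕ x ≡ 0v
⊕-self []      = refl
⊕-self (b ∷ x) = cong₂ _∷_ (xor-same b) (⊕-self x)

⊕-isAbelianGroup : ∀ {n} → IsAbelianGroup _≡_ (_⊕_ {n}) 0v id
⊕-isAbelianGroup = record
  { isGroup = record
    { isMonoid = record
      { isSemigroup = record
        { isMagma = record { isEquivalence = isEquivalence ; ∙-cong = cong₂ _⊕_ }
        ; assoc = zipWith-assoc xor-assoc
        }
      ; identity = zipWith-identityˡ xor-identityˡ , zipWith-identityʳ xor-identityʳ
      }
    ; inverse = ⊕-self , ⊕-self
    ; ⁻¹-cong = cong id
    }
  ; comm = zipWith-comm xor-comm
  }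

⊕-abelianGroup : ℕ → AbelianGroup 0ℓ 0ℓ
⊕-abelianGroup n = record { isAbelianGroup = ⊕-isAbelianGroup {n} }

module _ {n : ℕ} where
  open AbelianGroup (⊕-abelianGroup n) public
    using () renaming (assoc to ⊕-assoc; identityˡ to ⊕-identityˡ; identityʳ to ⊕-identityʳ)
  open import Algebra.Properties.AbelianGroup (⊕-abelianGroup n) public
    using () renaming (inverseˡ-unique to ⊕≡0v⇒≡)
  open import Algebra.Properties.CommutativeSemigroup (AbelianGroup.commutativeSemigroup (⊕-abelianGroup n)) public
    using () renaming (interchange to ⊕-interchange)

subsetSum-⊥ : ∀ {k n} (S : Points k n) → subsetSum S ⊥ ≡ 0v
subsetSum-⊥ {zero}  S = refl
subsetSum-⊥ {suc k} S = trans (⊕-identityˡ _) (subsetSum-⊥ (S ∘ suc))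

subsetSum-△ : ∀ {k n} (S : Points k n) (p q : Subset k) →
              subsetSum S (p △ q) ≡ subsetSum S p ⊕ subsetSum S q
subsetSum-△ S []      []      = sym (⊕-self 0v)
subsetSum-△ S (a ∷ p) (b ∷ q) = begin
  scale (a xor b) ⊕ subsetSum (S ∘ suc) (p △ q)
    ≡⟨ cong₂ _⊕_ (scale-xor a b) (subsetSum-△ (S ∘ suc) p q) ⟩
  (scale a ⊕ scale b) ⊕ (subsetSum (S ∘ suc) p ⊕ subsetSum (S ∘ suc) q)
    ≡⟨ ⊕-interchange _ _ _ _ ⟩
  (scale a ⊕ subsetSum (S ∘ suc) p) ⊕ (scale b ⊕ subsetSum (S ∘ suc) q) ∎
  where
  open ≡-Reasoning
  scale : Bool → F2^ _
  scale c = if c then S zero else 0v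
  scale-xor : ∀ a b → scale (a xor b) ≡ scale a ⊕ scale b
  scale-xor true  true  = sym (⊕-self (S zero))
  scale-xor true  false = sym (⊕-identityʳ (S zero))
  scale-xor false b     = sym (⊕-identityˡ (scale b))

subsetSum-⁅⁆ : ∀ {k n} (S : Points k n) (i : Fin k) → subsetSum S ⁅ i ⁆ ≡ S i
subsetSum-⁅⁆ S zero    = trans (cong (S zero ⊕_) (subsetSum-⊥ (S ∘ suc))) (⊕-identityʳ (S zero))
subsetSum-⁅⁆ S (suc i) = trans (⊕-identityˡ _) (subsetSum-⁅⁆ (S ∘ suc) i)

sameParity⇔even : ∀ m n → SameParity m n ⇔ Even (m + n)
sameParity⇔even 0             n             = mk⇔ sym sym
sameParity⇔even 1             0             = mk⇔ id id
sameParity⇔even 1             1             = mk⇔ (λ _ → refl) (λ _ → refl)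
sameParity⇔even 1             (suc (suc n)) = sameParity⇔even 1 n
sameParity⇔even (suc (suc m)) n             = sameParity⇔even m n

∣p∣≡∣p∩q∣+∣p─q∣ : ∀ {k} (p q : Subset k) → ∣ p ∣ ≡ ∣ p ∩ q ∣ + ∣ p ─ q ∣
∣p∣≡∣p∩q∣+∣p─q∣ []          []          = refl
∣p∣≡∣p∩q∣+∣p─q∣ (true ∷ p)  (true ∷ q)  = cong suc (∣p∣≡∣p∩q∣+∣p─q∣ p q)
∣p∣≡∣p∩q∣+∣p─q∣ (true ∷ p)  (false ∷ q) = trans (cong suc (∣p∣≡∣p∩q∣+∣p─q∣ p q)) (sym (+-suc _ _))
∣p∣≡∣p∩q∣+∣p─q∣ (false ∷ p) (true ∷ q)  = ∣p∣≡∣p∩q∣+∣p─q∣ p q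
∣p∣≡∣p∩q∣+∣p─q∣ (false ∷ p) (false ∷ q) = ∣p∣≡∣p∩q∣+∣p─q∣ p q

∣q∣≡∣p∩q∣+∣q─p∣ : ∀ {k} (p q : Subset k) → ∣ q ∣ ≡ ∣ p ∩ q ∣ + ∣ q ─ p ∣
∣q∣≡∣p∩q∣+∣q─p∣ p q = trans (∣p∣≡∣p∩q∣+∣p─q∣ q p) (cong (λ r → ∣ r ∣ + ∣ q ─ p ∣) (∩-comm q p))

∣p△q∣≡∣p─q∣+∣q─p∣ : ∀ {k} (p q : Subset k) → ∣ p △ q ∣ ≡ ∣ p ─ q ∣ + ∣ q ─ p ∣
∣p△q∣≡∣p─q∣+∣q─p∣ []          []          = refl
∣p△q∣≡∣p─q∣+∣q─p∣ (true ∷ p)  (true ∷ q)  = ∣p△q∣≡∣p─q∣+∣q─p∣ p q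
∣p△q∣≡∣p─q∣+∣q─p∣ (true ∷ p)  (false ∷ q) = cong suc (∣p△q∣≡∣p─q∣+∣q─p∣ p q)
∣p△q∣≡∣p─q∣+∣q─p∣ (false ∷ p) (true ∷ q)  = trans (cong suc (∣p△q∣≡∣p─q∣+∣q─p∣ p q)) (sym (+-suc _ _))
∣p△q∣≡∣p─q∣+∣q─p∣ (false ∷ p) (false ∷ q) = ∣p△q∣≡∣p─q∣+∣q─p∣ p q

∣p∩q∣+∣p─q∣+∣q─p∣≤n : ∀ {k} (p q : Subset k) → ∣ p ∩ q ∣ + ∣ p ─ q ∣ + ∣ q ─ p ∣ ≤ k
∣p∩q∣+∣p─q∣+∣q─p∣≤n []          []          = z≤n
∣p∩q∣+∣p─q∣+∣q─p∣≤n (true ∷ p)  (true ∷ q)  = s≤s (∣p∩q∣+∣p─q∣+∣q─p∣≤n p q)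
∣p∩q∣+∣p─q∣+∣q─p∣≤n {suc k} (true ∷ p) (false ∷ q) =
  subst (_≤ suc k) (cong (_+ ∣ q ─ p ∣) (sym (+-suc ∣ p ∩ q ∣ ∣ p ─ q ∣))) (s≤s (∣p∩q∣+∣p─q∣+∣q─p∣≤n p q))
∣p∩q∣+∣p─q∣+∣q─p∣≤n {suc k} (false ∷ p) (true ∷ q) =
  subst (_≤ suc k) (sym (+-suc (∣ p ∩ q ∣ + ∣ p ─ q ∣) ∣ q ─ p ∣)) (s≤s (∣p∩q∣+∣p─q∣+∣q─p∣≤n p q))
∣p∩q∣+∣p─q∣+∣q─p∣≤n (false ∷ p) (false ∷ q) = m≤n⇒m≤1+n (∣p∩q∣+∣p─q∣+∣q─p∣≤n p q)

even-△ : ∀ {k} (p q : Subset k) → Even ∣ p ∣ → Even ∣ q ∣ → Even ∣ p △ q ∣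
even-△ p q p-even q-even =
  subst Even (sym (∣p△q∣≡∣p─q∣+∣q─p∣ p q))
    (to (sameParity⇔even ∣ p ─ q ∣ ∣ q ─ p ∣) (trans (sym p∩q∼p─q) p∩q∼q─p))
  where
  open Equivalence
  p∩q∼p─q : SameParity ∣ p ∩ q ∣ ∣ p ─ q ∣
  p∩q∼p─q = from (sameParity⇔even ∣ p ∩ q ∣ ∣ p ─ q ∣) (subst Even (∣p∣≡∣p∩q∣+∣p─q∣ p q) p-even)
  p∩q∼q─p : SameParity ∣ p ∩ q ∣ ∣ q ─ p ∣
  p∩q∼q─p = from (sameParity⇔even ∣ p ∩ q ∣ ∣ q ─ p ∣) (subst Even (∣q∣≡∣p∩q∣+∣q─p∣ p q) q-even)

InE-△ : ∀ {k n} (S : Points k n) (p q : Subset k) → InE S p → InE S q → InE S (p △ q)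
InE-△ S p q (p-even , p-sum) (q-even , q-sum) =
  even-△ p q p-even q-even ,
  trans (subsetSum-△ S p q) (trans (cong₂ _⊕_ p-sum q-sum) (⊕-self 0v))

-- Caps are the sets without short dependencies

fromList : ∀ {k} → List (Fin k) → Subset k
fromList = foldr (λ i p → ⁅ i ⁆ △ p) ⊥

sumOver : ∀ {k n} → Points k n → List (Fin k) → F2^ n
sumOver S = foldr (λ i x → S i ⊕ x) 0v

subsetSum-fromList : ∀ {k n} (S : Points k n) is → subsetSum S (fromList is) ≡ sumOver S is
subsetSum-fromList S []       = subsetSum-⊥ S
subsetSum-fromList S (i ∷ is) =
  trans (subsetSum-△ S ⁅ i ⁆ (fromList is)) (cong₂ _⊕_ (subsetSum-⁅⁆ S i) (subsetSum-fromList S is))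

x∉p∧x∉q⇒x∉p△q : ∀ {k} {x : Fin k} {p q} → x ∉ p → x ∉ q → x ∉ p △ q
x∉p∧x∉q⇒x∉p△q {x = zero}  {true ∷ p}              x∉p _   = ⊥-elim (x∉p here)
x∉p∧x∉q⇒x∉p△q {x = zero}  {false ∷ p} {true ∷ q}  _   x∉q = ⊥-elim (x∉q here)
x∉p∧x∉q⇒x∉p△q {x = zero}  {false ∷ p} {false ∷ q} _   _   ()
x∉p∧x∉q⇒x∉p△q {x = suc x} {_ ∷ p}     {_ ∷ q}     x∉p x∉q (there x∈p△q) =
  x∉p∧x∉q⇒x∉p△q (x∉p ∘ there) (x∉q ∘ there) x∈p△q

x∈p∧x∈q⇒x∉p△q : ∀ {k} {x : Fin k} {p q} → x ∈ p → x ∈ q → x ∉ p △ q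
x∈p∧x∈q⇒x∉p△q here        here        ()
x∈p∧x∈q⇒x∉p△q (there x∈p) (there x∈q) (there x∈p△q) = x∈p∧x∈q⇒x∉p△q x∈p x∈q x∈p△q

∣⁅x⁆△p∣≡1+∣p∣ : ∀ {k} {x : Fin k} {p} → x ∉ p → ∣ ⁅ x ⁆ △ p ∣ ≡ suc ∣ p ∣
∣⁅x⁆△p∣≡1+∣p∣ {x = zero}  {true ∷ p}  x∉p = ⊥-elim (x∉p here)
∣⁅x⁆△p∣≡1+∣p∣ {x = zero}  {false ∷ p} _   = cong (suc ∘ ∣_∣) (⊕-identityˡ p)
∣⁅x⁆△p∣≡1+∣p∣ {x = suc x} {true ∷ p}  x∉p = cong suc (∣⁅x⁆△p∣≡1+∣p∣ (x∉p ∘ there))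
∣⁅x⁆△p∣≡1+∣p∣ {x = suc x} {false ∷ p} x∉p = ∣⁅x⁆△p∣≡1+∣p∣ (x∉p ∘ there)

∉⇒∉fromList : ∀ {k} {x : Fin k} {is} → All (x ≢_) is → x ∉ fromList is
∉⇒∉fromList []           = ∉⊥
∉⇒∉fromList (x≢i ∷ x∉is) = x∉p∧x∉q⇒x∉p△q (x≢y⇒x∉⁅y⁆ x≢i) (∉⇒∉fromList x∉is)

∣fromList∣ : ∀ {k} {is : List (Fin k)} → Unique is → ∣ fromList is ∣ ≡ length is
∣fromList∣ {k} []             = ∣⊥∣≡0 k
∣fromList∣ (i∉is ∷ is-unique) = trans (∣⁅x⁆△p∣≡1+∣p∣ (∉⇒∉fromList i∉is)) (cong suc (∣fromList∣ is-unique))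

fromList-map-suc : ∀ {k} (is : List (Fin k)) → fromList (map suc is) ≡ false ∷ fromList is
fromList-map-suc []       = refl
fromList-map-suc (i ∷ is) = cong (⁅ suc i ⁆ △_) (fromList-map-suc is)

fromList-surjective : ∀ {k} (p : Subset k) → ∃ λ is → Unique is × fromList is ≡ p
fromList-surjective []      = [] , [] , refl
fromList-surjective (b ∷ p) with fromList-surjective p
... | is , is-unique , refl with b
...   | false = map suc is , Unique.map⁺ suc-injective is-unique , fromList-map-suc is
...   | true  =
  zero ∷ map suc is ,
  All.map⁺ (universal (λ _ ()) is) ∷ Unique.map⁺ suc-injective is-unique ,
  trans (cong (⁅ zero ⁆ △_) (fromList-map-suc is)) (cong (true ∷_) (⊕-identityˡ (fromList is)))

LongDependencies : ∀ {k n} → Points k n → Set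
LongDependencies S = ∀ U → InE S U → U ≢ ⊥ → 6 ≤ ∣ U ∣

module _ {k n} {S : Points k n} where

  private
    sum₂ : ∀ i j → sumOver S (i ∷ j ∷ []) ≡ S i ⊕ S j
    sum₂ i j = cong (S i ⊕_) (⊕-identityʳ (S j))

    sum₄ : ∀ i j l m → sumOver S (i ∷ j ∷ l ∷ m ∷ []) ≡ (S i ⊕ S j) ⊕ (S l ⊕ S m)
    sum₄ i j l m = trans (cong (λ x → S i ⊕ (S j ⊕ x)) (sum₂ l m)) (sym (⊕-assoc (S i) (S j) (S l ⊕ S m)))

  capSet⇒longDependencies : IsSet S → IsCap S → LongDependencies S
  capSet⇒longDependencies injective cap U (U-even , U-sum) U≢⊥ with fromList-surjective U
  ... | is , is-unique , refl =
    subst (6 ≤_) (sym (∣fromList∣ is-unique))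
      (length≥6 is is-unique (subst Even (∣fromList∣ is-unique) U-even)
         (trans (sym (subsetSum-fromList S is)) U-sum) U≢⊥)
    where
    length≥6 : ∀ is → Unique is → Even (length is) → sumOver S is ≡ 0v → fromList is ≢ ⊥ → 6 ≤ length is
    length≥6 []                       _ _  _ ≢⊥ = ⊥-elim (≢⊥ refl)
    length≥6 (i ∷ j ∷ [])             ((i≢j ∷ []) ∷ _) _ sum _ =
      ⊥-elim (i≢j (injective (⊕≡0v⇒≡ (S i) (S j) (trans (sym (sum₂ i j)) sum))))
    length≥6 (i ∷ j ∷ l ∷ m ∷ [])
             ((i≢j ∷ i≢l ∷ i≢m ∷ []) ∷ (j≢l ∷ j≢m ∷ []) ∷ (l≢m ∷ []) ∷ _) _ sum _ =
      ⊥-elim (cap i j l m i≢j i≢l i≢m j≢l j≢m l≢m (trans (sym (sum₄ i j l m)) sum))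
    length≥6 (_ ∷ _ ∷ _ ∷ _ ∷ _ ∷ _ ∷ is) _ _ _ _ = m≤m+n 6 (length is)
    length≥6 (_ ∷ [])                 _ ()
    length≥6 (_ ∷ _ ∷ _ ∷ [])         _ ()
    length≥6 (_ ∷ _ ∷ _ ∷ _ ∷ _ ∷ []) _ ()

  longDependencies⇒capSet : LongDependencies S → IsSet S × IsCap S
  longDependencies⇒capSet long = injective , cap
    where
    length≥6 : ∀ {i is} → Unique (i ∷ is) → Even (length (i ∷ is)) → sumOver S (i ∷ is) ≡ 0v →
               6 ≤ length (i ∷ is)
    length≥6 {i} {is} is-unique even sum =
      subst (6 ≤_) (∣fromList∣ is-unique)
        (long (fromList (i ∷ is))
           (subst Even (sym (∣fromList∣ is-unique)) even , trans (subsetSum-fromList S (i ∷ is)) sum)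
           λ eq → 0≢1+n (trans (sym (∣⊥∣≡0 k)) (trans (cong ∣_∣ (sym eq)) (∣fromList∣ is-unique))))

    injective : IsSet S
    injective {i} {j} Si≡Sj with i ≟ j
    ... | yes i≡j = i≡j
    ... | no  i≢j with length≥6 ((i≢j ∷ []) ∷ [] ∷ []) refl
                         (trans (sum₂ i j) (trans (cong (_⊕ S j) Si≡Sj) (⊕-self (S j))))
    ...   | s≤s (s≤s ())

    cap : IsCap S
    cap i j l m i≢j i≢l i≢m j≢l j≢m l≢m sum
      with length≥6 ((i≢j ∷ i≢l ∷ i≢m ∷ []) ∷ (j≢l ∷ j≢m ∷ []) ∷ (l≢m ∷ []) ∷ [] ∷ []) refl
                     (trans (sum₄ i j l m) sum)
    ... | s≤s (s≤s (s≤s (s≤s ())))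

  capSet⇔longDependencies : (IsSet S × IsCap S) ⇔ LongDependencies S
  capSet⇔longDependencies =
    mk⇔ (λ (injective , cap) → capSet⇒longDependencies injective cap) longDependencies⇒capSet

-- Bases of E(S) and admissible region sizes

⊆⊎∃∉ : ∀ {k} (p q : Subset k) → p ⊆ q ⊎ ∃ λ x → x ∈ p × x ∉ q
⊆⊎∃∉ p q with any? (λ x → x ∈? p ×-dec ¬? (x ∈? q))
... | yes p⊈q = inj₂ p⊈q
... | no  p⊆q = inj₁ λ {x} x∈p → decidable-stable (x ∈? q) λ x∉q → p⊆q (x , x∈p , x∉q)

∣p∣<∣p∪⁅x⁆∣ : ∀ {k} {x : Fin k} {p} → x ∉ p → ∣ p ∣ < ∣ p ∪ ⁅ x ⁆ ∣
∣p∣<∣p∪⁅x⁆∣ {x = x} x∉p = p⊂q⇒∣p∣<∣q∣ (p⊆p∪q ⁅ x ⁆ , x , x∈p∪q⁺ (inj₂ (x∈⁅x⁆ x)) , x∉p)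

x∉p∧y∉p⇒2+∣p∣≤n : ∀ {k} {x y : Fin k} {p} → x ≢ y → x ∉ p → y ∉ p → 2 + ∣ p ∣ ≤ k
x∉p∧y∉p⇒2+∣p∣≤n {x = x} {y} {p} x≢y x∉p y∉p =
  ≤-trans (s≤s (∣p∣<∣p∪⁅x⁆∣ {p = p} x∉p))
          (≤-trans (∣p∣<∣p∪⁅x⁆∣ {p = p ∪ ⁅ x ⁆} y∉p∪⁅x⁆) (∣p∣≤n ((p ∪ ⁅ x ⁆) ∪ ⁅ y ⁆)))
  where
  y∉p∪⁅x⁆ : y ∉ p ∪ ⁅ x ⁆
  y∉p∪⁅x⁆ = [ y∉p , x≢y⇒x∉⁅y⁆ (x≢y ∘ sym) ]′ ∘ x∈p∪q⁻ p ⁅ x ⁆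

Even≥6 : ℕ → Set
Even≥6 s = Even s × 6 ≤ s

record Admissible (k x y z : ℕ) : Set where
  constructor admissible
  field
    sum≤k    : x + y + z ≤ k
    even≥6₁₂ : Even≥6 (x + y)
    even≥6₁₃ : Even≥6 (x + z)
    even≥6₂₃ : Even≥6 (y + z)

admissible-regions⇔even≥6 : ∀ {k} (p q : Subset k) →
  Admissible k (∣ p ∩ q ∣) (∣ p ─ q ∣) (∣ q ─ p ∣) ⇔ (Even≥6 ∣ p ∣ × Even≥6 ∣ q ∣ × Even≥6 ∣ p △ q ∣)
admissible-regions⇔even≥6 p q = mk⇔
  (λ (admissible _ p-sizes q-sizes p△q-sizes) →
     subst Even≥6 (sym p≡) p-sizes , subst Even≥6 (sym q≡) q-sizes , subst Even≥6 (sym p△q≡) p△q-sizes)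
  (λ (p-sizes , q-sizes , p△q-sizes) →
     admissible (∣p∩q∣+∣p─q∣+∣q─p∣≤n p q) (subst Even≥6 p≡ p-sizes) (subst Even≥6 q≡ q-sizes) (subst Even≥6 p△q≡ p△q-sizes))
  where
  p≡ = ∣p∣≡∣p∩q∣+∣p─q∣ p q
  q≡ = ∣q∣≡∣p∩q∣+∣q─p∣ p q
  p△q≡ = ∣p△q∣≡∣p─q∣+∣q─p∣ p q

affIndep⇒∃∉ : ∀ {k n} {S : Points k n} {T X} →
              AffIndep S T → InE S X → X ≢ ⊥ → ∃ λ x → x ∈ X × x ∉ T
affIndep⇒∃∉ {T = T} {X} T-indep X∈E X≢⊥ with ⊆⊎∃∉ X T
... | inj₁ X⊆T = ⊥-elim (X≢⊥ (T-indep X X⊆T X∈E))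
... | inj₂ X⊈T = X⊈T

module _ {k n} {S : Points k n} {X₁ X₂ : Subset k} where

  private
    △-nonzero : IsBasisE S X₁ X₂ → InE S (X₁ △ X₂) × X₁ △ X₂ ≢ ⊥
    △-nonzero (X₁∈E , X₂∈E , _ , _ , X₁≢X₂ , _) = InE-△ S X₁ X₂ X₁∈E X₂∈E , X₁≢X₂ ∘ ⊕≡0v⇒≡ X₁ X₂

  longDependencies⇔even≥6-basis : IsBasisE S X₁ X₂ →
    LongDependencies S ⇔ (Even≥6 ∣ X₁ ∣ × Even≥6 ∣ X₂ ∣ × Even≥6 ∣ X₁ △ X₂ ∣)
  longDependencies⇔even≥6-basis basis@(X₁∈E , X₂∈E , X₁≢⊥ , X₂≢⊥ , _ , span) =
    let X₁△X₂∈E , X₁△X₂≢⊥ = △-nonzero basis in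
    mk⇔
      (λ long → (proj₁ X₁∈E , long X₁ X₁∈E X₁≢⊥) , (proj₁ X₂∈E , long X₂ X₂∈E X₂≢⊥) ,
                (proj₁ X₁△X₂∈E , long (X₁ △ X₂) X₁△X₂∈E X₁△X₂≢⊥))
      (λ (X₁-sizes , X₂-sizes , X₁△X₂-sizes) U U∈E U≢⊥ → case span U U∈E of λ where
         (inj₁ U≡⊥)                 → ⊥-elim (U≢⊥ U≡⊥)
         (inj₂ (inj₁ refl))         → proj₂ X₁-sizes
         (inj₂ (inj₂ (inj₁ refl)))  → proj₂ X₂-sizes
         (inj₂ (inj₂ (inj₂ refl)))  → proj₂ X₁△X₂-sizes)

  affIndep⇒2+∣T∣≤k : ∀ {T} → IsBasisE S X₁ X₂ → AffIndep S T → 2 + ∣ T ∣ ≤ k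
  affIndep⇒2+∣T∣≤k basis@(X₁∈E , X₂∈E , X₁≢⊥ , X₂≢⊥ , _) T-indep
    with affIndep⇒∃∉ T-indep X₁∈E X₁≢⊥ | affIndep⇒∃∉ T-indep X₂∈E X₂≢⊥
       | affIndep⇒∃∉ T-indep (proj₁ (△-nonzero basis)) (proj₂ (△-nonzero basis))
  ... | x , x∈X₁ , x∉T | y , y∈X₂ , y∉T | w , w∈X₁△X₂ , w∉T with x ≟ y
  ...   | no  x≢y  = x∉p∧y∉p⇒2+∣p∣≤n x≢y x∉T y∉T
  ...   | yes refl = x∉p∧y∉p⇒2+∣p∣≤n (λ { refl → x∈p∧x∈q⇒x∉p△q x∈X₁ y∈X₂ w∈X₁△X₂ }) w∉T x∉T

admissible-swap₁₂ : ∀ {k x y z} → Admissible k x y z → Admissible k y x z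
admissible-swap₁₂ {k} {x} {y} {z} (admissible sum≤k xy xz yz) =
  admissible (subst (λ s → s + z ≤ k) (+-comm x y) sum≤k) (subst Even≥6 (+-comm x y) xy) yz xz

admissible-swap₂₃ : ∀ {k x y z} → Admissible k x y z → Admissible k x z y
admissible-swap₂₃ {k} {x} {y} {z} (admissible sum≤k xy xz yz) =
  admissible (subst (_≤ k) x+y+z≡x+z+y sum≤k) xz xy (subst Even≥6 (+-comm y z) yz)
  where
  x+y+z≡x+z+y : x + y + z ≡ x + z + y
  x+y+z≡x+z+y = trans (+-assoc x y z) (trans (cong (x +_) (+-comm y z)) (sym (+-assoc x z y)))

admissible-permute : ∀ {k x y z a b c} → SameMultiset3 x y z a b c → Admissible k x y z → Admissible k a b c
admissible-permute (inj₁ (refl , refl , refl))                               = id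
admissible-permute (inj₂ (inj₁ (refl , refl , refl)))                        = admissible-swap₂₃
admissible-permute (inj₂ (inj₂ (inj₁ (refl , refl , refl))))                 = admissible-swap₁₂
admissible-permute (inj₂ (inj₂ (inj₂ (inj₁ (refl , refl , refl)))))          = admissible-swap₁₂ ∘ admissible-swap₂₃
admissible-permute (inj₂ (inj₂ (inj₂ (inj₂ (inj₁ (refl , refl , refl))))))   = admissible-swap₂₃ ∘ admissible-swap₁₂
admissible-permute (inj₂ (inj₂ (inj₂ (inj₂ (inj₂ (refl , refl , refl)))))) =
  admissible-swap₁₂ ∘ admissible-swap₂₃ ∘ admissible-swap₁₂

admissible⇔conditions : ∀ {k a b c} → a ≤ b → b ≤ c →
  Admissible k a b c ⇔ ((a + b + c ≤ k) × (SameParity a b × SameParity b c) × (6 ≤ a + b))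
admissible⇔conditions {k} {a} {b} {c} a≤b b≤c = mk⇔
  (λ (admissible sum≤k (a+b-even , a+b≥6) _ (b+c-even , _)) →
     sum≤k , (from (sameParity⇔even a b) a+b-even , from (sameParity⇔even b c) b+c-even) , a+b≥6)
  (λ (sum≤k , (a∼b , b∼c) , a+b≥6) →
     let a+c≥6 = ≤-trans a+b≥6 (+-monoʳ-≤ a b≤c) in
     admissible sum≤k
       (to (sameParity⇔even a b) a∼b , a+b≥6)
       (to (sameParity⇔even a c) (trans a∼b b∼c) , a+c≥6)
       (to (sameParity⇔even b c) b∼c , ≤-trans a+c≥6 (+-monoˡ-≤ c a≤b)))
  where open Equivalence

vennRealizable⇒admissible : ∀ {k n a b c} → VennRealizable k n a b c → Admissible k a b c
vennRealizable⇒admissible (S , injective , cap , _ , _ , _ , X₁ , X₂ , basis , regions≈abc) =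
  admissible-permute regions≈abc
    (from (admissible-regions⇔even≥6 X₁ X₂)
      (to (longDependencies⇔even≥6-basis basis) (capSet⇒longDependencies injective cap)))
  where open Equivalence

-- The construction

pad : ∀ {m} t → Vec Bool m → F2^ (m + t)
pad t B = B ++ replicate t false

pad≡0v⇒≡⊥ : ∀ {m} t (B : Vec Bool m) → pad t B ≡ 0v → B ≡ ⊥
pad≡0v⇒≡⊥ t []      _  = refl
pad≡0v⇒≡⊥ t (b ∷ B) eq = cong₂ _∷_ (proj₁ (∷-injective eq)) (pad≡0v⇒≡⊥ t B (proj₂ (∷-injective eq)))

unit : ∀ {m} t → Fin m → F2^ (m + t)
unit t zero    = true ∷ 0v
unit t (suc j) = false ∷ unit t j

subsetSum-false∷ : ∀ {k n} (S : Points k n) (B : Subset k) →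
                   subsetSum (λ i → false ∷ S i) B ≡ false ∷ subsetSum S B
subsetSum-false∷ S []          = refl
subsetSum-false∷ S (true ∷ B)  = cong (_ ⊕_) (subsetSum-false∷ (S ∘ suc) B)
subsetSum-false∷ S (false ∷ B) = cong (0v ⊕_) (subsetSum-false∷ (S ∘ suc) B)

subsetSum-unit : ∀ {m} t (B : Vec Bool m) → subsetSum (unit t) B ≡ pad t B
subsetSum-unit t []          = refl
subsetSum-unit t (true ∷ B)  = trans (cong (_ ⊕_) (subsetSum-false∷ (unit t) B))
                                     (cong (true ∷_) (trans (⊕-identityˡ _) (subsetSum-unit t B)))
subsetSum-unit t (false ∷ B) = trans (cong (0v ⊕_) (subsetSum-false∷ (unit t) B))
                                     (cong (false ∷_) (trans (⊕-identityˡ _) (subsetSum-unit t B)))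

-- The point 0 goes into X₁ ∖ X₂ rather than staying isolated, so that a + b + c = k is reachable.
module Construction {m : ℕ} (t : ℕ) (u v : Vec Bool m) where

  S : Points (3 + m) (m + t)
  S zero                = 0v
  S (suc zero)          = pad t u
  S (suc (suc zero))    = pad t v
  S (suc (suc (suc j))) = unit t j

  X₁ X₂ T₀ : Subset (3 + m)
  X₁ = true  ∷ true  ∷ false ∷ u
  X₂ = false ∷ false ∷ true  ∷ v
  T₀ = true  ∷ false ∷ false ∷ ⊤

  subsetSum-S : ∀ a b c B →
    subsetSum S (a ∷ b ∷ c ∷ B) ≡ (if b then pad t u else 0v) ⊕ ((if c then pad t v else 0v) ⊕ pad t B)
  subsetSum-S a b c B =
    trans (cong (_⊕ _) (if-eta a)) (trans (⊕-identityˡ _) (cong (λ x → _ ⊕ (_ ⊕ x)) (subsetSum-unit t B)))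

  even-head : ∀ a → Even ∣ a ∷ false ∷ false ∷ ⊥ {m} ∣ → a ≡ false
  even-head false _ = refl
  even-head true  even with subst (Even ∘ suc) (∣⊥∣≡0 m) even
  ... | ()

  subsetSum-T₀ : ∀ a B → subsetSum S (a ∷ false ∷ false ∷ B) ≡ pad t B
  subsetSum-T₀ a B = trans (subsetSum-S a false false B) (trans (⊕-identityˡ _) (⊕-identityˡ _))

  T₀-dependency≡⊥ : ∀ {a B} → InE S (a ∷ false ∷ false ∷ B) → a ∷ false ∷ false ∷ B ≡ ⊥
  T₀-dependency≡⊥ {a} {B} (even , sum≡0v) with pad≡0v⇒≡⊥ t B (trans (sym (subsetSum-T₀ a B)) sum≡0v)
  ... | refl = cong (_∷ _) (even-head a even)

  X₁∈E : Even ∣ X₁ ∣ → InE S X₁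
  X₁∈E even = even , trans (subsetSum-S true true false u)
                       (trans (cong (pad t u ⊕_) (⊕-identityˡ (pad t u))) (⊕-self (pad t u)))

  X₂∈E : Even ∣ X₂ ∣ → InE S X₂
  X₂∈E even = even , trans (subsetSum-S false false true v) (trans (⊕-identityˡ _) (⊕-self (pad t v)))

  -- Y differs by a dependency inside T₀ from the one of ⊥, X₁, X₂, X₁ △ X₂ with the same ū- and v̄-entries.
  span : InE S X₁ → InE S X₂ → ∀ Y → InE S Y → Y ≡ ⊥ ⊎ Y ≡ X₁ ⊎ Y ≡ X₂ ⊎ Y ≡ (X₁ △ X₂)
  span _    _    (_ ∷ false ∷ false ∷ _) Y∈E = inj₁ (T₀-dependency≡⊥ Y∈E)
  span X₁∈E _    Y@(_ ∷ true ∷ false ∷ _) Y∈E =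
    inj₂ (inj₁ (⊕≡0v⇒≡ Y X₁ (T₀-dependency≡⊥ (InE-△ S Y X₁ Y∈E X₁∈E))))
  span _    X₂∈E Y@(_ ∷ false ∷ true ∷ _) Y∈E =
    inj₂ (inj₂ (inj₁ (⊕≡0v⇒≡ Y X₂ (T₀-dependency≡⊥ (InE-△ S Y X₂ Y∈E X₂∈E)))))
  span X₁∈E X₂∈E Y@(_ ∷ true ∷ true ∷ _) Y∈E =
    inj₂ (inj₂ (inj₂ (⊕≡0v⇒≡ Y (X₁ △ X₂)
      (T₀-dependency≡⊥ (InE-△ S Y (X₁ △ X₂) Y∈E (InE-△ S X₁ X₂ X₁∈E X₂∈E))))))

  basis : Even ∣ X₁ ∣ → Even ∣ X₂ ∣ → IsBasisE S X₁ X₂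
  basis X₁-even X₂-even =
    X₁∈E X₁-even , X₂∈E X₂-even , (λ ()) , (λ ()) , (λ ()) , span (X₁∈E X₁-even) (X₂∈E X₂-even)

  T₀-independent : AffIndep S T₀
  T₀-independent (_ ∷ false ∷ false ∷ _) _ U∈E = T₀-dependency≡⊥ U∈E
  T₀-independent (_ ∷ true ∷ _ ∷ _) U⊆T₀ _ with U⊆T₀ (there here)
  ... | there ()
  T₀-independent (_ ∷ false ∷ true ∷ _) U⊆T₀ _ with U⊆T₀ (there (there here))
  ... | there (there ())

  hasDim : IsBasisE S X₁ X₂ → HasDim S m
  hasDim X-basis =
    (T₀ , T₀-independent , cong suc (∣⊤∣≡n m)) ,
    λ T T-indep → s≤s⁻¹ (s≤s⁻¹ (affIndep⇒2+∣T∣≤k X-basis T-indep))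

  vennRealizable : ∀ {a b c} → SameMultiset3 (∣ X₁ ∩ X₂ ∣) (∣ X₁ ─ X₂ ∣) (∣ X₂ ─ X₁ ∣) a b c →
                   Admissible (3 + m) (∣ X₁ ∩ X₂ ∣) (∣ X₁ ─ X₂ ∣) (∣ X₂ ─ X₁ ∣) →
                   VennRealizable (3 + m) (m + t) a b c
  vennRealizable regions≈abc adm =
    let X₁-sizes , X₂-sizes , X₁△X₂-sizes = to (admissible-regions⇔even≥6 X₁ X₂) adm
        X-basis = basis (proj₁ X₁-sizes) (proj₁ X₂-sizes)
        injective , cap = from capSet⇔longDependencies
                            (from (longDependencies⇔even≥6-basis X-basis) (X₁-sizes , X₂-sizes , X₁△X₂-sizes))
    in S , injective , cap , m , hasDim X-basis , +-comm m 3 , X₁ , X₂ , X-basis , regions≈abc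
    where open Equivalence

regionVectors : ∀ i p q r → ∃ λ (u : Vec Bool (i + p + q + r)) → ∃ λ v →
                ∣ u ∩ v ∣ ≡ i × ∣ u ─ v ∣ ≡ p × ∣ v ─ u ∣ ≡ q
regionVectors (suc i) p q r with regionVectors i p q r
... | u , v , ∩≡ , ─≡ , ─≡′ = true ∷ u , true ∷ v , cong suc ∩≡ , ─≡ , ─≡′
regionVectors 0 (suc p) q r with regionVectors 0 p q r
... | u , v , ∩≡ , ─≡ , ─≡′ = true ∷ u , false ∷ v , ∩≡ , cong suc ─≡ , ─≡′
regionVectors 0 0 (suc q) r with regionVectors 0 0 q r
... | u , v , ∩≡ , ─≡ , ─≡′ = false ∷ u , true ∷ v , ∩≡ , ─≡ , cong suc ─≡′
regionVectors 0 0 0 (suc r) with regionVectors 0 0 0 r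
... | u , v , ∩≡ , ─≡ , ─≡′ = false ∷ u , false ∷ v , ∩≡ , ─≡ , ─≡′
regionVectors 0 0 0 0 = [] , [] , refl , refl , refl

a+[2+b]+[1+c]+r≡3+[a+b+c+r] : ∀ a b c r → a + suc (suc b) + suc c + r ≡ 3 + (a + b + c + r)
a+[2+b]+[1+c]+r≡3+[a+b+c+r] = solve-∀

admissible⇒vennRealizable : ∀ {k n a b c} → k ≤ n + 3 → a ≤ b → b ≤ c →
                            Admissible k a b c → VennRealizable k n a b c
admissible⇒vennRealizable {b = 0} _ z≤n _ (admissible _ (_ , ()) _ _)
admissible⇒vennRealizable {b = 1} _ z≤n _ (admissible _ (_ , s≤s ()) _ _)
admissible⇒vennRealizable {b = 1} _ (s≤s z≤n) _ (admissible _ (_ , s≤s (s≤s ())) _ _)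
admissible⇒vennRealizable {b = suc (suc _)} {c = 0} _ _ () _
admissible⇒vennRealizable {k} {n} {a} {suc (suc b)} {suc c} k≤n+3 _ _ adm
  with r , a+b+c+r≡k ← m≤n⇒∃[o]m+o≡n (Admissible.sum≤k adm)
  with refl ← trans (sym a+b+c+r≡k) (a+[2+b]+[1+c]+r≡3+[a+b+c+r] a b c r)
  with t , refl ← m≤n⇒∃[o]m+o≡n
                    (+-cancelˡ-≤ 3 (a + b + c + r) n (subst (3 + (a + b + c + r) ≤_) (+-comm n 3) k≤n+3))
  with u , v , ∩≡ , ─≡ , ─≡′ ← regionVectors a b c r =
  vennRealizable regions≡abc (admissible-permute abc≡regions adm)
  where
  open Construction t u v
  regions≡abc : SameMultiset3 (∣ X₁ ∩ X₂ ∣) (∣ X₁ ─ X₂ ∣) (∣ X₂ ─ X₁ ∣) a (suc (suc b)) (suc c)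
  regions≡abc = inj₁ (∩≡ , cong (λ x → suc (suc x)) ─≡ , cong suc ─≡′)
  abc≡regions : SameMultiset3 a (suc (suc b)) (suc c) (∣ X₁ ∩ X₂ ∣) (∣ X₁ ─ X₂ ∣) (∣ X₂ ─ X₁ ∣)
  abc≡regions = inj₁ (sym ∩≡ , cong (λ x → suc (suc x)) (sym ─≡) , cong suc (sym ─≡′))

theorem6p3 : (k n : ℕ) → 0 < k → k ≤ n + 3 → (a b c : ℕ) → a ≤ b → b ≤ c →
    VennRealizable k n a b c ⇔
      ((a + b + c ≤ k) × (SameParity a b × SameParity b c) × (6 ≤ a + b))
theorem6p3 k n _ k≤n+3 a b c a≤b b≤c =
  ⇔-trans (mk⇔ vennRealizable⇒admissible (admissible⇒vennRealizable k≤n+3 a≤b b≤c))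
          (admissible⇔conditions a≤b b≤c)
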